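{- Let $n\ge 3$ be an odd integer and let $j\ge 1$ be an integer. Then for each positive odd integer $k$, $(1,(n^{j}-1)^{nk},(n^{j}-1)^{nk}+1)$ is an $abc$ triple.
   Context: For a positive integer $n$, $\operatorname{rad}(n)$ denotes the product of the distinct prime factors of $n$. An $abc$ triple is a triple $(a,b,c)$ of relatively prime positive integers with $a+b=c$ and $\operatorname{rad}(abc)<c$. -}

module Defs where

open import Data.Nat using (ℕ; suc; _+_; _*_; _<_)
open import Data.Nat.Divisibility using (_∣_; _∣?_)
open import Data.Nat.Primality using (Prime; prime?)
open import Data.Nat.Coprimality using (Coprime)
open import Data.List using (List; filter; upTo)
open import Data.Nat.ListAction using (product)
open import Relation.Nullary using (¬_)
open import Data.Product using (_×_)
open import Relation.Nullary.Decidable using (_×-dec_)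

-- The primes dividing n, listed among 0,1,...,n (each prime divisor of n ≥ 1 is ≤ n).
primeDivisors : ℕ → List ℕ
primeDivisors n = filter (λ p → prime? p ×-dec (p ∣? n)) (upTo (suc n))

rad : ℕ → ℕ
rad n = product (primeDivisors n)

IsAbcTriple : ℕ → ℕ → ℕ → Set
IsAbcTriple a b c =
  (0 < a) × (0 < b) × (0 < c) ×
  (Coprime a b × Coprime a c × Coprime b c) ×
  (a + b ≡ c) × (rad (a * b * c) < c)
  where open import Relation.Binary.PropositionalEquality using (_≡_)

Odd : ℕ → Set
Odd n = ¬ (2 ∣ n)

-- Put m = n ^ j ∸ 1, so that m + 1 = n ^ j, and c = m ^ (n k) + 1 = x ^ n + 1 with x = m ^ k.
-- For odd e, x ^ e + 1 ≡ e (x + 1) modulo (x + 1)²; hence m + 1 ∣ x + 1 (as k is odd), so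
-- n ∣ x + 1, and then n (x + 1) ∣ x ^ n + 1 (as n is odd).  Thus c = (m + 1) n w, and every
-- prime factor of m ^ (n k) · c divides m, n or w, so rad (m ^ (n k) · c) ≤ m n w < c.
module Submission where

open import Defs
open import Data.Nat using (ℕ; zero; suc; _+_; _*_; _^_; _∸_; _≤_; _≥_; _<_; NonZero; >-nonZero; ≢-nonZero; z<s; s≤s; z≤n)
open import Data.Nat.Properties
open import Data.Nat.Divisibility
open import Data.Nat.Primality using (Prime; prime?; euclidsLemma; prime⇒irreducible; prime⇒nonTrivial)
open import Data.Nat.Coprimality using (1-coprimeTo; coprime-+)
import Data.Nat.Coprimality as Coprimality
open import Data.Nat.ListAction using (product)
open import Data.List using ([]; _∷_; upTo)
open import Data.List.Relation.Unary.All using (All; []; _∷_)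
import Data.List.Relation.Unary.All as All
open import Data.List.Relation.Unary.All.Properties using (all-filter)
open import Data.List.Relation.Unary.AllPairs using (_∷_)
open import Data.List.Relation.Unary.Unique.Propositional using (Unique)
open import Data.List.Relation.Unary.Unique.Propositional.Properties using (filter⁺; upTo⁺)
open import Data.Integer as ℤ using (ℤ; +_; 1ℤ)
import Data.Integer.Properties as ℤ
import Data.Integer.Divisibility.Signed as ℤ
open import Data.Integer.Tactic.RingSolver using (solve-∀)
open import Data.Product using (_×_; _,_; proj₁)
open import Data.Sum using (inj₁; inj₂)
open import Relation.Nullary using (¬_; contradiction)
open import Relation.Nullary.Decidable using (_×-dec_)
open import Relation.Unary using (Decidable)
open import Relation.Binary.PropositionalEquality

prime≢1 : ∀ {p} → Prime p → p ≢ 1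
prime≢1 p-prime refl with prime⇒nonTrivial p-prime
... | ()

prime∣m^n⇒prime∣m : ∀ {p} m n → Prime p → p ∣ m ^ n → p ∣ m
prime∣m^n⇒prime∣m m zero    p-prime p∣1 = contradiction (∣1⇒≡1 p∣1) (prime≢1 p-prime)
prime∣m^n⇒prime∣m m (suc n) p-prime p∣m^1+n with euclidsLemma m (m ^ n) p-prime p∣m^1+n
... | inj₁ p∣m   = p∣m
... | inj₂ p∣m^n = prime∣m^n⇒prime∣m m n p-prime p∣m^n

prime∤product-of-other-primes : ∀ {p} qs → Prime p → All Prime qs → All (p ≢_) qs → ¬ p ∣ product qs
prime∤product-of-other-primes []       p-prime []               []             p∣1 =
  prime≢1 p-prime (∣1⇒≡1 p∣1)
prime∤product-of-other-primes (q ∷ qs) p-prime (q-prime ∷ prime) (p≢q ∷ p≢qs) p∣q*qs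
  with euclidsLemma q (product qs) p-prime p∣q*qs
... | inj₂ p∣qs = prime∤product-of-other-primes qs p-prime prime p≢qs p∣qs
... | inj₁ p∣q with prime⇒irreducible q-prime p∣q
...   | inj₁ p≡1 = prime≢1 p-prime p≡1
...   | inj₂ p≡q = p≢q p≡q

product-of-distinct-prime-divisors-∣ : ∀ m ps → Unique ps → All (λ p → Prime p × p ∣ m) ps → product ps ∣ m
product-of-distinct-prime-divisors-∣ m []       _            _ = 1∣ m
product-of-distinct-prime-divisors-∣ m (p ∷ ps) (p∉ps ∷ distinct) ((p-prime , p∣m) ∷ divisors)
  with product-of-distinct-prime-divisors-∣ m ps distinct divisors
... | divides t m≡t*ps with euclidsLemma t (product ps) p-prime (subst (p ∣_) m≡t*ps p∣m)
...   | inj₁ p∣t   = subst (p * product ps ∣_) (sym m≡t*ps) (*-monoˡ-∣ (product ps) p∣t)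
...   | inj₂ p∣ps = contradiction p∣ps
        (prime∤product-of-other-primes ps p-prime (All.map proj₁ divisors) p∉ps)

rad∣ : ∀ n m → (∀ {p} → Prime p → p ∣ n → p ∣ m) → rad n ∣ m
rad∣ n m prime-divisors-divide = product-of-distinct-prime-divisors-∣ m _
  (filter⁺ P? (upTo⁺ (suc n)))
  (All.map (λ { (p-prime , p∣n) → p-prime , prime-divisors-divide p-prime p∣n })
           (all-filter P? (upTo (suc n))))
  where
  P? : Decidable (λ p → Prime p × p ∣ n)
  P? p = prime? p ×-dec (p ∣? n)

Odd-2+⇒Odd : ∀ {e} → Odd (suc (suc e)) → Odd e
Odd-2+⇒Odd odd-2+e 2∣e = odd-2+e (∣m∣n⇒∣m+n (∣-refl {2}) 2∣e)

-- Over ℤ because the cofactor is negative for small x (it is -2 for x = 0, e = 3).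
[x+1]*[x+1]∣x^e+1-[x+1]*e : ∀ (x : ℤ) e → Odd e →
  (x ℤ.+ 1ℤ) ℤ.* (x ℤ.+ 1ℤ) ℤ.∣ x ℤ.^ e ℤ.+ 1ℤ ℤ.- (x ℤ.+ 1ℤ) ℤ.* + e
[x+1]*[x+1]∣x^e+1-[x+1]*e x zero          odd-0 = contradiction (2 ∣0) odd-0
[x+1]*[x+1]∣x^e+1-[x+1]*e x (suc zero)    _     = ℤ.divides (+ 0) (base x)
  where
  base : ∀ x → x ℤ.* 1ℤ ℤ.+ 1ℤ ℤ.- (x ℤ.+ 1ℤ) ℤ.* 1ℤ ≡ + 0 ℤ.* ((x ℤ.+ 1ℤ) ℤ.* (x ℤ.+ 1ℤ))
  base = solve-∀
[x+1]*[x+1]∣x^e+1-[x+1]*e x (suc (suc e)) odd-2+e =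
  subst (_ ℤ.∣_) (sym step)
    (ℤ.∣m∣n⇒∣m+n (ℤ.∣n⇒∣m*n (x ℤ.* x) ([x+1]*[x+1]∣x^e+1-[x+1]*e x e (Odd-2+⇒Odd odd-2+e)))
                 (ℤ.∣n⇒∣m*n (+ e ℤ.* (x ℤ.- 1ℤ) ℤ.- 1ℤ) ℤ.∣-refl))
  where
  open ≡-Reasoning
  identity : ∀ x P E → x ℤ.* (x ℤ.* P) ℤ.+ 1ℤ ℤ.- (x ℤ.+ 1ℤ) ℤ.* (+ 2 ℤ.+ E)
           ≡ x ℤ.* x ℤ.* (P ℤ.+ 1ℤ ℤ.- (x ℤ.+ 1ℤ) ℤ.* E)
             ℤ.+ (E ℤ.* (x ℤ.- 1ℤ) ℤ.- 1ℤ) ℤ.* ((x ℤ.+ 1ℤ) ℤ.* (x ℤ.+ 1ℤ))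
  identity = solve-∀
  step : x ℤ.^ suc (suc e) ℤ.+ 1ℤ ℤ.- (x ℤ.+ 1ℤ) ℤ.* + suc (suc e)
       ≡ x ℤ.* x ℤ.* (x ℤ.^ e ℤ.+ 1ℤ ℤ.- (x ℤ.+ 1ℤ) ℤ.* + e)
         ℤ.+ (+ e ℤ.* (x ℤ.- 1ℤ) ℤ.- 1ℤ) ℤ.* ((x ℤ.+ 1ℤ) ℤ.* (x ℤ.+ 1ℤ))
  step = begin
    x ℤ.^ suc (suc e) ℤ.+ 1ℤ ℤ.- (x ℤ.+ 1ℤ) ℤ.* + suc (suc e)
      ≡⟨ cong (λ E → x ℤ.^ suc (suc e) ℤ.+ 1ℤ ℤ.- (x ℤ.+ 1ℤ) ℤ.* E) (ℤ.pos-+ 2 e) ⟩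
    x ℤ.* (x ℤ.* x ℤ.^ e) ℤ.+ 1ℤ ℤ.- (x ℤ.+ 1ℤ) ℤ.* (+ 2 ℤ.+ + e)
      ≡⟨ identity x (x ℤ.^ e) (+ e) ⟩
    x ℤ.* x ℤ.* (x ℤ.^ e ℤ.+ 1ℤ ℤ.- (x ℤ.+ 1ℤ) ℤ.* + e)
      ℤ.+ (+ e ℤ.* (x ℤ.- 1ℤ) ℤ.- 1ℤ) ℤ.* ((x ℤ.+ 1ℤ) ℤ.* (x ℤ.+ 1ℤ)) ∎

[x+1]*d∣x^e+1 : ∀ x e d → Odd e → d ∣ e → d ∣ x + 1 → (x + 1) * d ∣ x ^ e + 1
[x+1]*d∣x^e+1 x e d odd-e d∣e d∣x+1 =
  ℤ.∣⇒∣ᵤ (subst₂ ℤ._∣_ (sym (ℤ.pos-* (x + 1) d)) (sym [x^e+1]↑) [X+1]*d∣X^e+1)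
  where
  X+1 X^e+1 : ℤ
  X+1   = + x ℤ.+ 1ℤ
  X^e+1 = (+ x) ℤ.^ e ℤ.+ 1ℤ
  difference+subtrahend : ∀ a b → a ℤ.- b ℤ.+ b ≡ a
  difference+subtrahend = solve-∀
  [X+1]*d∣X^e+1 : X+1 ℤ.* + d ℤ.∣ X^e+1
  [X+1]*d∣X^e+1 = subst (_ ℤ.∣_) (difference+subtrahend X^e+1 (X+1 ℤ.* + e))
    (ℤ.∣m∣n⇒∣m+n
      (ℤ.∣-trans (ℤ.*-monoʳ-∣ X+1 (ℤ.∣ᵤ⇒∣ {+ d} {X+1} d∣x+1))
                 ([x+1]*[x+1]∣x^e+1-[x+1]*e (+ x) e odd-e))
      (ℤ.*-monoʳ-∣ X+1 (ℤ.∣ᵤ⇒∣ {+ d} {+ e} d∣e)))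
  pos-^ : ∀ a n → + (a ^ n) ≡ (+ a) ℤ.^ n
  pos-^ a zero    = refl
  pos-^ a (suc n) = trans (ℤ.pos-* a (a ^ n)) (cong (+ a ℤ.*_) (pos-^ a n))
  [x^e+1]↑ : + (x ^ e + 1) ≡ X^e+1
  [x^e+1]↑ = cong (ℤ._+ 1ℤ) (pos-^ x e)

rad[m^e*[m^e+1]]<m^e+1 : ∀ m e q .{{_ : NonZero m}} → m ^ e + 1 ≡ (m + 1) * q →
  (∀ {p} → Prime p → p ∣ m + 1 → p ∣ q) → rad (1 * m ^ e * (m ^ e + 1)) < m ^ e + 1
rad[m^e*[m^e+1]]<m^e+1 m e zero c≡[m+1]*0 _ =
  contradiction (trans c≡[m+1]*0 (*-zeroʳ (m + 1))) (m+1+n≢0 (m ^ e))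
rad[m^e*[m^e+1]]<m^e+1 m e q@(suc _) c≡[m+1]*q prime-divisors-of-m+1 = begin-strict
  rad (1 * m ^ e * (m ^ e + 1)) ≤⟨ ∣⇒≤ {{m*n≢0 m q}} (rad∣ _ (m * q) prime∣m*q) ⟩
  m * q                         <⟨ *-monoˡ-< q (m<m+n m z<s) ⟩
  (m + 1) * q                   ≡⟨ c≡[m+1]*q ⟨
  m ^ e + 1                     ∎
  where
  open ≤-Reasoning
  prime∣m*q : ∀ {p} → Prime p → p ∣ 1 * m ^ e * (m ^ e + 1) → p ∣ m * q
  prime∣m*q {p} p-prime p∣abc with euclidsLemma (1 * m ^ e) (m ^ e + 1) p-prime p∣abc
  ... | inj₁ p∣b = ∣m⇒∣m*n q (prime∣m^n⇒prime∣m m e p-prime (subst (p ∣_) (*-identityˡ (m ^ e)) p∣b))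
  ... | inj₂ p∣c with euclidsLemma (m + 1) q p-prime (subst (p ∣_) c≡[m+1]*q p∣c)
  ...   | inj₁ p∣m+1 = ∣n⇒∣m*n m (prime-divisors-of-m+1 p-prime p∣m+1)
  ...   | inj₂ p∣q   = ∣n⇒∣m*n m p∣q

abc-triple[1,m^e,m^e+1] : ∀ m e n .{{_ : NonZero m}} → (∀ {p} → Prime p → p ∣ m + 1 → p ∣ n) →
  (m + 1) * n ∣ m ^ e + 1 → IsAbcTriple 1 (m ^ e) (m ^ e + 1)
abc-triple[1,m^e,m^e+1] m e n prime-divisors-of-m+1 [m+1]*n∣c =
  z<s , m^n>0 m e , m≤n+m 1 (m ^ e) ,
  (1-coprimeTo _ , 1-coprimeTo _ , Coprimality.sym (coprime-+ (1-coprimeTo (m ^ e)))) ,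
  +-comm 1 (m ^ e) ,
  rad[m^e*[m^e+1]]<m^e+1 m e (n * w) c≡[m+1]*[n*w]
    (λ p-prime p∣m+1 → ∣m⇒∣m*n w (prime-divisors-of-m+1 p-prime p∣m+1))
  where
  w : ℕ
  w = quotient [m+1]*n∣c
  c≡[m+1]*[n*w] : m ^ e + 1 ≡ (m + 1) * (n * w)
  c≡[m+1]*[n*w] = trans (m∣n⇒n≡m*quotient [m+1]*n∣c) (*-assoc (m + 1) n w)

[m+1]*n∣m^[n*k]+1 : ∀ m n k → n ∣ m + 1 → Odd n → Odd k → (m + 1) * n ∣ m ^ (n * k) + 1
[m+1]*n∣m^[n*k]+1 m n k n∣m+1 odd-n odd-k = begin
  (m + 1) * n       ∣⟨ *-monoˡ-∣ n m+1∣m^k+1 ⟩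
  (m ^ k + 1) * n   ∣⟨ [x+1]*d∣x^e+1 (m ^ k) n n odd-n ∣-refl (∣-trans n∣m+1 m+1∣m^k+1) ⟩
  (m ^ k) ^ n + 1   ≡⟨ cong (_+ 1) (trans (^-*-assoc m k n) (cong (m ^_) (*-comm k n))) ⟩
  m ^ (n * k) + 1   ∎
  where
  open ∣-Reasoning
  m+1∣m^k+1 : m + 1 ∣ m ^ k + 1
  m+1∣m^k+1 = subst (_∣ m ^ k + 1) (*-identityʳ (m + 1)) ([x+1]*d∣x^e+1 m k 1 odd-k (1∣ k) (1∣ (m + 1)))

corollary3p12 : (n j k : ℕ) → n ≥ 3 → Odd n → j ≥ 1 → 1 ≤ k → Odd k →
    IsAbcTriple 1 ((n ^ j ∸ 1) ^ (n * k)) ((n ^ j ∸ 1) ^ (n * k) + 1)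
corollary3p12 n zero    k _   _     ()  _ _
corollary3p12 n (suc j) k n≥3 odd-n _ _ odd-k =
  abc-triple[1,m^e,m^e+1] m (n * k) n {{≢-nonZero (m>n⇒m∸n≢0 1<n^[1+j])}}
    (λ {p} p-prime p∣m+1 → prime∣m^n⇒prime∣m n (suc j) p-prime (subst (p ∣_) m+1≡n^[1+j] p∣m+1))
    ([m+1]*n∣m^[n*k]+1 m n k (subst (n ∣_) (sym m+1≡n^[1+j]) (m∣m*n (n ^ j))) odd-n odd-k)
  where
  instance
    n≢0 : NonZero n
    n≢0 = >-nonZero (≤-trans z<s n≥3)
  1<n^[1+j] : 1 < n ^ suc j
  1<n^[1+j] = ≤-trans (s≤s (s≤s z≤n)) (≤-trans n≥3 (m≤m*n n (n ^ j) {{m^n≢0 n j}}))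
  m : ℕ
  m = n ^ suc j ∸ 1
  m+1≡n^[1+j] : m + 1 ≡ n ^ suc j
  m+1≡n^[1+j] = m∸n+n≡m (<⇒≤ 1<n^[1+j])
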